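{- Let $G$ be a $2$-edge-connected graph, and fix a base vertex $x_0\in V(G)$. The following are equivalent: (1) the canonical map $\psi_G:E(G)\to\mathbb{P}(\mathcal{H}^1(G))$ is injective; (2) the map $S^{(2)}_{x_0}:\mathrm{Div}^2_+(G)\to\mathrm{Jac}(G)$ is injective; (3) $G$ is $3$-edge-connected.
   Context: A graph is a finite, connected multigraph without loop edges. It is $k$-edge-connected if deleting any set of at most $k-1$ edges leaves it connected. $\mathrm{Div}^2_+(G)$ is the set of effective divisors of degree $2$ on $G$, i.e. formal sums $(x_1)+(x_2)$ with $x_1,x_2\in V(G)$. For $f:V(G)\to\mathbb{Z}$, $\mathrm{div}(f)=\sum_x\sum_{e=xy}(f(x)-f(y))(x)$. $\mathrm{Jac}(G)$ is the group of degree-zero divisors modulo $\{\mathrm{div}(f)\}$. Define $S^{(2)}_{x_0}((x_1)+(x_2))=[(x_1)-(x_0)]+[(x_2)-(x_0)]\in\mathrm{Jac}(G)$. $\mathcal{H}^1(G)$ is the real vector space of functions $\omega$ on directed edges with $\omega(\bar e)=-\omega(e)$ and $\sum_{t(e)=x}\omega(e)=0$ for every vertex $x$, where $t(e)$ is the terminus of $e$. $\mathbb{P}(\mathcal{H}^1(G))$ denotes the set of hyperplanes (codimension-one linear subspaces) of $\mathcal{H}^1(G)$. The canonical map sends an edge $e$ to $W(e)=\{\omega\in\mathcal{H}^1(G):\omega(e)=0\}$; this is a hyperplane since $G$ is $2$-edge-connected.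
   Formalization: The space $\mathcal{H}^1(G)$ of harmonic forms is taken over the rationals instead of the reals, so the hyperplanes $W(e)$ consist of rational forms. -}

module Defs where

open import Data.Nat as ℕ using (ℕ; zero; suc; _<_)
open import Data.Fin as Fin using (Fin; zero; suc; _≟_)
open import Data.Fin.Subset using (Subset; _∉_; ∣_∣)
open import Data.Integer as ℤ using (ℤ)
open import Data.Rational as ℚ using (ℚ; 0ℚ)
open import Data.Bool using (if_then_else_)
open import Data.Product using (Σ; ∃; _×_; _,_)
open import Relation.Binary.PropositionalEquality using (_≡_; _≢_)
open import Relation.Nullary.Decidable using (⌊_⌋)
open import Function.Bundles using (_⇔_)

Σℤ : ∀ {k} → (Fin k → ℤ) → ℤ
Σℤ {zero} f = ℤ.0ℤ
Σℤ {suc k} f = f zero ℤ.+ Σℤ (λ i → f (suc i))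

Σℚ : ∀ {k} → (Fin k → ℚ) → ℚ
Σℚ {zero} f = 0ℚ
Σℚ {suc k} f = f zero ℚ.+ Σℚ (λ i → f (suc i))

-- A finite loopless multigraph: vertices Fin n, edges Fin m, each edge
-- carrying a reference orientation src e → tgt e.
record Graph : Set where
  field
    n   : ℕ
    m   : ℕ
    src : Fin m → Fin n
    tgt : Fin m → Fin n
    noLoop : ∀ e → src e ≢ tgt e

open Graph public

data Reach (G : Graph) (S : Subset (m G)) : Fin (n G) → Fin (n G) → Set where
  here : ∀ {u} → Reach G S u u
  fwd  : ∀ {u} e → e ∉ S → Reach G S (tgt G e) u → Reach G S (src G e) u
  bwd  : ∀ {u} e → e ∉ S → Reach G S (src G e) u → Reach G S (tgt G e) u

ConnectedMinus : (G : Graph) → Subset (m G) → Set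
ConnectedMinus G S = ∀ u v → Reach G S u v

EdgeConnected : ℕ → Graph → Set
EdgeConnected k G = ∀ (S : Subset (m G)) → ∣ S ∣ < k → ConnectedMinus G S

-- Harmonic 1-forms (with values in ℚ), as functions on edges in their
-- reference orientation; ω(ē) = -ω(e) is built in. The condition at x is
-- Σ_{t(e)=x} ω(e) = 0 over directed edges: an edge with tgt = x contributes
-- ω e, an edge with src = x contributes ω(ē) = -ω e.
inflow : (G : Graph) → (Fin (m G) → ℚ) → Fin (n G) → Fin (m G) → ℚ
inflow G ω x e =
  (if ⌊ tgt G e ≟ x ⌋ then ω e else 0ℚ) ℚ.+ (if ⌊ src G e ≟ x ⌋ then ℚ.- ω e else 0ℚ)

Harmonic : (G : Graph) → (Fin (m G) → ℚ) → Set
Harmonic G ω = ∀ x → Σℚ (inflow G ω x) ≡ 0ℚ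

-- ψ_G(e) = W(e) = {ω ∈ H¹ : ω(e) = 0}.  ψ_G injective: W(e) = W(e') ⇒ e = e'.
PsiInjective : Graph → Set
PsiInjective G = ∀ (e e' : Fin (m G)) →
  (∀ ω → Harmonic G ω → ((ω e ≡ 0ℚ) ⇔ (ω e' ≡ 0ℚ))) → e ≡ e'

Divisor : Graph → Set
Divisor G = Fin (n G) → ℤ

δ : (G : Graph) → Fin (n G) → Divisor G
δ G x y = if ⌊ x ≟ y ⌋ then ℤ.1ℤ else ℤ.0ℤ

divF : (G : Graph) → (Fin (n G) → ℤ) → Divisor G
divF G f x = Σℤ λ e →
  (if ⌊ src G e ≟ x ⌋ then f x ℤ.- f (tgt G e) else ℤ.0ℤ) ℤ.+
  (if ⌊ tgt G e ≟ x ⌋ then f x ℤ.- f (src G e) else ℤ.0ℤ)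

JacEq : (G : Graph) → Divisor G → Divisor G → Set
JacEq G D D' = ∃ λ (f : Fin (n G) → ℤ) → ∀ x → D x ℤ.- D' x ≡ divF G f x

eff2 : (G : Graph) → Fin (n G) → Fin (n G) → Divisor G
eff2 G x₁ x₂ y = δ G x₁ y ℤ.+ δ G x₂ y

-- Representative of S⁽²⁾_{x0}((x1)+(x2)) = [(x1)-(x0)] + [(x2)-(x0)].
S2 : (G : Graph) → Fin (n G) → Fin (n G) → Fin (n G) → Divisor G
S2 G x₀ x₁ x₂ y = ((δ G x₁ y ℤ.- δ G x₀ y) ℤ.+ (δ G x₂ y ℤ.- δ G x₀ y))

S2Injective : (G : Graph) → Fin (n G) → Set
S2Injective G x₀ = ∀ x₁ x₂ y₁ y₂ →
  JacEq G (S2 G x₀ x₁ x₂) (S2 G x₀ y₁ y₂) → ∀ y → eff2 G x₁ x₂ y ≡ eff2 G y₁ y₂ y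

-- All three conditions fail exactly when some two edges e₁ ≠ e₂ form a cut, i.e. are the only
-- edges joining a vertex set A to its complement; for a 2-edge-connected graph that is not
-- 3-edge-connected such a cut is the boundary of the set of vertices still reachable from a
-- fixed vertex after deleting at most two edges. Given the cut, the divisor of the indicator
-- of A is (a₁) − (b₁) + (a₂) − (b₂) with aᵢ ∈ A ∌ bᵢ, so S⁽²⁾ identifies (a₁) + (a₂) with
-- (b₁) + (b₂); and a harmonic form has zero net flux ±ω(e₁) ± ω(e₂) into A, so W(e₁) = W(e₂).
-- Conversely let G be 3-edge-connected. If D − D′ = div f with D, D′ effective of degree 2,
-- summing div f over the set where f is maximal counts at least one for each of the ≥ 3 edges
-- leaving it, but at most deg D = 2, so f is constant and D = D′. For e ≠ e′, a walk from t(e′)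
-- to s(e′) avoiding e and e′ closes e′ into a cycle, whose flow is a harmonic form vanishing
-- on e but not on e′.

module Submission where

open import Defs
open import Algebra.Bundles using (CommutativeMonoid)
open import Data.Bool as Bool using (Bool; true; false; if_then_else_)
open import Data.Fin using (Fin; zero; suc; _≟_; punchIn)
open import Data.Fin.Properties using (punchInᵢ≢i; any?; all?; ¬∀⟶∃¬; suc-injective)
open import Data.Fin.Subset using (Subset; _∈_; _∉_; _⊆_; ∣_∣; ⁅_⁆; _∪_)
open import Data.Fin.Subset.Properties
  using (_∈?_; p⊆q⇒∣p∣≤∣q∣; p⊂q⇒∣p∣<∣q∣; ∣p∣≤n; x∈⁅x⁆; x∈⁅y⁆⇒x≡y; ∣⁅x⁆∣≡1; p⊆p∪q; q⊆p∪q)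
open import Data.Integer as ℤ using (ℤ; +_; 0ℤ; 1ℤ)
import Data.Integer.Properties as ℤP
open import Data.Integer.Tactic.RingSolver using (solve-∀)
open import Data.Nat as ℕ using (zero; suc; z≤n; s≤s)
import Data.Nat.Properties as ℕ
open import Data.Rational as ℚ using (ℚ; 0ℚ; 1ℚ)
import Data.Rational.Properties as ℚP
open import Data.Rational.Solver using (module +-*-Solver)
open import Data.Product using (Σ; ∃; ∃₂; _×_; _,_; proj₁; proj₂)
open import Data.Sum using (_⊎_; inj₁; inj₂; [_,_])
open import Data.Vec using (_∷_; []; lookup; tabulate; here; there)
open import Data.Vec.Properties using (lookup∘tabulate; []=⇒lookup; lookup⇒[]=)
open import Function.Base using (_∘_)
open import Function.Bundles using (_⇔_; mk⇔; Equivalence)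
open import Function.Properties.Equivalence using () renaming (sym to ⇔-sym; trans to ⇔-trans)
open import Relation.Binary.PropositionalEquality as ≡ using (_≡_; _≢_)
open import Relation.Nullary using (¬_; Dec; yes; no; ¬?)
open import Relation.Nullary.Decidable using (⌊_⌋; _×-dec_; _⊎-dec_; decidable-stable)
open import Relation.Nullary.Negation using (contradiction)
open import Relation.Unary using (Pred; Decidable)

module FiniteSums {c ℓ} (M : CommutativeMonoid c ℓ) where

  open CommutativeMonoid M
    renaming (_∙_ to _+_; ε to 0#; identityˡ to +-identityˡ; identityʳ to +-identityʳ; ∙-cong to +-cong)
  open import Algebra.Properties.CommutativeMonoid.Sum M public
  open import Relation.Binary.Reasoning.Setoid setoid

  sum-zero : ∀ {k} {f : Fin k → Carrier} → (∀ i → f i ≈ 0#) → sum f ≈ 0#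
  sum-zero {k} f≈0 = trans (sum-cong-≋ f≈0) (sum-replicate-zero k)

  sum-point : ∀ {k} {f : Fin k → Carrier} (j : Fin k) → (∀ i → i ≢ j → f i ≈ 0#) → sum f ≈ f j
  sum-point {suc k} {f} j off = begin
    sum f                              ≈⟨ sum-remove f ⟩
    f j + sum (λ i → f (punchIn j i))  ≈⟨ +-cong refl (sum-zero (λ i → off _ (punchInᵢ≢i j i))) ⟩
    f j + 0#                           ≈⟨ +-identityʳ (f j) ⟩
    f j                                ∎

  sum-pair : ∀ {k} {f : Fin k → Carrier} (j l : Fin k) → j ≢ l →
             (∀ i → i ≢ j → i ≢ l → f i ≈ 0#) → sum f ≈ f j + f l
  sum-pair {k} {f} j l j≢l off = begin
    sum f                                  ≈⟨ sum-cong-≋ split ⟩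
    sum (λ i → at j i + at l i)            ≈⟨ ∑-distrib-+ (at j) (at l) ⟩
    sum (at j) + sum (at l)                ≈⟨ +-cong (sum-point j (at-off j)) (sum-point l (at-off l)) ⟩
    at j j + at l l                        ≈⟨ +-cong (at-self j) (at-self l) ⟩
    f j + f l                              ∎
    where
    at : Fin k → Fin k → Carrier
    at j i = if ⌊ i ≟ j ⌋ then f j else 0#
    at-off : ∀ j i → i ≢ j → at j i ≈ 0#
    at-off j i i≢j with i ≟ j
    ... | yes i≡j = contradiction i≡j i≢j
    ... | no _    = refl
    at-self : ∀ j → at j j ≈ f j
    at-self j with j ≟ j
    ... | yes _  = refl
    ... | no j≢j = contradiction ≡.refl j≢j
    split : ∀ i → f i ≈ at j i + at l i
    split i with i ≟ j | i ≟ l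
    ... | yes ≡.refl | yes i≡l = contradiction i≡l j≢l
    ... | yes ≡.refl | no _    = sym (+-identityʳ _)
    ... | no _ | yes ≡.refl    = sym (+-identityˡ _)
    ... | no i≢j | no i≢l      = trans (off i i≢j i≢l) (sym (+-identityˡ 0#))

  sumOver : ∀ {k} → (Fin k → Bool) → (Fin k → Carrier) → Carrier
  sumOver a f = sum (λ i → if a i then f i else 0#)

  sumOver-+ : ∀ {k} (a : Fin k → Bool) (f g : Fin k → Carrier) →
              sumOver a (λ i → f i + g i) ≈ sumOver a f + sumOver a g
  sumOver-+ a f g =
    trans (sum-cong-≋ split) (∑-distrib-+ (λ i → if a i then f i else 0#) (λ i → if a i then g i else 0#))
    where
    split : ∀ i → (if a i then f i + g i else 0#) ≈ (if a i then f i else 0#) + (if a i then g i else 0#)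
    split i with a i
    ... | true  = refl
    ... | false = sym (+-identityˡ 0#)

  sumOver-point : ∀ {k} (a : Fin k → Bool) (u : Fin k) (p : Fin k → Carrier) →
                  sumOver a (λ i → if ⌊ u ≟ i ⌋ then p i else 0#) ≈ (if a u then p u else 0#)
  sumOver-point a u p = trans (sum-point u off) at-u
    where
    off : ∀ i → i ≢ u → (if a i then (if ⌊ u ≟ i ⌋ then p i else 0#) else 0#) ≈ 0#
    off i i≢u with a i | u ≟ i
    ... | true  | yes u≡i = contradiction (≡.sym u≡i) i≢u
    ... | true  | no _    = refl
    ... | false | _       = refl
    at-u : (if a u then (if ⌊ u ≟ u ⌋ then p u else 0#) else 0#) ≈ (if a u then p u else 0#)
    at-u with a u | u ≟ u
    ... | true  | yes _  = refl
    ... | true  | no u≢u = contradiction ≡.refl u≢u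
    ... | false | _      = refl

  sumOver-sum : ∀ {k l} (a : Fin k → Bool) (F : Fin l → Fin k → Carrier) →
                sumOver a (λ i → sum (λ j → F j i)) ≈ sum (λ j → sumOver a (F j))
  sumOver-sum {l = l} a F = trans (sum-cong-≋ pull) (∑-comm (λ i j → if a i then F j i else 0#))
    where
    pull : ∀ i → (if a i then sum (λ j → F j i) else 0#) ≈ sum (λ j → if a i then F j i else 0#)
    pull i with a i
    ... | true  = refl
    ... | false = sym (sum-zero {l} (λ _ → refl))

⌊⌋-≢ : ∀ {A B : Set} (A? : Dec A) (B? : Dec B) → ¬ A → B → ⌊ A? ⌋ ≢ ⌊ B? ⌋
⌊⌋-≢ (yes a) _       ¬a _ = contradiction a ¬a
⌊⌋-≢ (no _)  (yes _) _  _ = λ ()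
⌊⌋-≢ _       (no ¬b) _  b = contradiction b ¬b

∈-tabulate⇔ : ∀ {k p} {P : Pred (Fin k) p} (P? : Decidable P) {i} → i ∈ tabulate (λ j → ⌊ P? j ⌋) ⇔ P i
∈-tabulate⇔ {P = P} P? {i} = mk⇔ to from
  where
  lookup-i : lookup (tabulate (λ j → ⌊ P? j ⌋)) i ≡ ⌊ P? i ⌋
  lookup-i = lookup∘tabulate (λ j → ⌊ P? j ⌋) i
  to : i ∈ tabulate (λ j → ⌊ P? j ⌋) → P i
  to i∈ with P? i | ≡.trans (≡.sym lookup-i) ([]=⇒lookup i∈)
  ... | yes Pi | _ = Pi
  ... | no _   | ()
  from : P i → i ∈ tabulate (λ j → ⌊ P? j ⌋)
  from Pi with P? i | lookup-i
  ... | yes _  | eq = lookup⇒[]= i _ eq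
  ... | no ¬Pi | _  = contradiction Pi ¬Pi

∣p∣≡0⇒∉ : ∀ {k} {p : Subset k} → ∣ p ∣ ≡ 0 → ∀ i → i ∉ p
∣p∣≡0⇒∉ {p = false ∷ p} eq (suc i) (there i∈p) = ∣p∣≡0⇒∉ eq i i∈p

∣p∣≡1⇒singleton : ∀ {k} {p : Subset k} → ∣ p ∣ ≡ 1 → ∃ λ i → i ∈ p × (∀ j → j ∈ p → j ≡ i)
∣p∣≡1⇒singleton {p = true ∷ p} eq = zero , here , only
  where
  only : ∀ j → j ∈ true ∷ p → j ≡ zero
  only zero    _           = ≡.refl
  only (suc j) (there j∈p) = contradiction j∈p (∣p∣≡0⇒∉ (ℕ.suc-injective eq) j)
∣p∣≡1⇒singleton {p = false ∷ p} eq with ∣p∣≡1⇒singleton eq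
... | i , i∈p , only = suc i , there i∈p , λ { (suc j) (there j∈p) → ≡.cong suc (only j j∈p) }

∣p∣≡2⇒pair : ∀ {k} {p : Subset k} → ∣ p ∣ ≡ 2 →
             ∃₂ λ i j → i ≢ j × i ∈ p × j ∈ p × (∀ l → l ∈ p → l ≡ i ⊎ l ≡ j)
∣p∣≡2⇒pair {p = true ∷ p} eq with ∣p∣≡1⇒singleton (ℕ.suc-injective eq)
... | j , j∈p , only = zero , suc j , (λ ()) , here , there j∈p , pair-only
  where
  pair-only : ∀ l → l ∈ true ∷ p → l ≡ zero ⊎ l ≡ suc j
  pair-only zero    _           = inj₁ ≡.refl
  pair-only (suc l) (there l∈p) = inj₂ (≡.cong suc (only l l∈p))
∣p∣≡2⇒pair {p = false ∷ p} eq with ∣p∣≡2⇒pair eq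
... | i , j , i≢j , i∈p , j∈p , only =
  suc i , suc j , i≢j ∘ suc-injective , there i∈p , there j∈p , pair-only
  where
  pair-only : ∀ l → l ∈ false ∷ p → l ≡ suc i ⊎ l ≡ suc j
  pair-only (suc l) (there l∈p) with only l l∈p
  ... | inj₁ l≡i = inj₁ (≡.cong suc l≡i)
  ... | inj₂ l≡j = inj₂ (≡.cong suc l≡j)

∣p∪q∣≤∣p∣+∣q∣ : ∀ {k} (p q : Subset k) → ∣ p ∪ q ∣ ℕ.≤ ∣ p ∣ ℕ.+ ∣ q ∣
∣p∪q∣≤∣p∣+∣q∣ []          []          = z≤n
∣p∪q∣≤∣p∣+∣q∣ (true ∷ p)  (true ∷ q)  =
  s≤s (ℕ.≤-trans (∣p∪q∣≤∣p∣+∣q∣ p q) (ℕ.+-monoʳ-≤ ∣ p ∣ (ℕ.n≤1+n ∣ q ∣)))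
∣p∪q∣≤∣p∣+∣q∣ (true ∷ p)  (false ∷ q) = s≤s (∣p∪q∣≤∣p∣+∣q∣ p q)
∣p∪q∣≤∣p∣+∣q∣ (false ∷ p) (true ∷ q)  =
  ℕ.≤-trans (s≤s (∣p∪q∣≤∣p∣+∣q∣ p q)) (ℕ.≤-reflexive (≡.sym (ℕ.+-suc ∣ p ∣ ∣ q ∣)))
∣p∪q∣≤∣p∣+∣q∣ (false ∷ p) (false ∷ q) = ∣p∪q∣≤∣p∣+∣q∣ p q

module _ (G : Graph) where

  Reach-invariant : ∀ {T} {A : Set} (φ : Fin (n G) → A) → (∀ e → e ∉ T → φ (src G e) ≡ φ (tgt G e)) →
                    ∀ {x y} → Reach G T x y → φ x ≡ φ y
  Reach-invariant φ flat here          = ≡.refl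
  Reach-invariant φ flat (fwd e e∉T r) = ≡.trans (flat e e∉T) (Reach-invariant φ flat r)
  Reach-invariant φ flat (bwd e e∉T r) = ≡.trans (≡.sym (flat e e∉T)) (Reach-invariant φ flat r)

  crossing : (Fin (n G) → Bool) → Subset (m G)
  crossing a = tabulate (λ e → ⌊ ¬? (a (src G e) Bool.≟ a (tgt G e)) ⌋)

  ∈crossing⇔ : ∀ a {e} → e ∈ crossing a ⇔ a (src G e) ≢ a (tgt G e)
  ∈crossing⇔ a = ∈-tabulate⇔ (λ e → ¬? (a (src G e) Bool.≟ a (tgt G e)))

  ∉crossing⇒flat : ∀ a e → e ∉ crossing a → a (src G e) ≡ a (tgt G e)
  ∉crossing⇒flat a e e∉ =
    decidable-stable (a (src G e) Bool.≟ a (tgt G e)) (e∉ ∘ Equivalence.from (∈crossing⇔ a))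

  EdgeConnected⇒∣crossing∣≥ : ∀ {k} → EdgeConnected k G → ∀ a {u v} → a u ≢ a v → k ℕ.≤ ∣ crossing a ∣
  EdgeConnected⇒∣crossing∣≥ connected a {u} {v} au≢av =
    ℕ.≮⇒≥ λ small → au≢av (Reach-invariant a (∉crossing⇒flat a) (connected (crossing a) small u v))

record Separation (G : Graph) (S : Subset (m G)) (u v : Fin (n G)) : Set where
  field
    side      : Fin (n G) → Bool
    separates : side u ≢ side v
    respects  : ∀ e → e ∉ S → side (src G e) ≡ side (tgt G e)

module Saturation (G : Graph) (S : Subset (m G)) (v : Fin (n G)) where

  Adjacent : Subset (n G) → Fin (n G) → Set
  Adjacent R w = ∃ λ e → e ∉ S × (src G e ≡ w × tgt G e ∈ R ⊎ tgt G e ≡ w × src G e ∈ R)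

  adjacent? : ∀ R w → Dec (Adjacent R w)
  adjacent? R w = any? λ e → ¬? (e ∈? S) ×-dec
    ((src G e ≟ w ×-dec tgt G e ∈? R) ⊎-dec (tgt G e ≟ w ×-dec src G e ∈? R))

  grow : Subset (n G) → Subset (n G)
  grow R = tabulate (λ w → ⌊ w ∈? R ⊎-dec adjacent? R w ⌋)

  Reaches : Subset (n G) → Set
  Reaches R = ∀ {w} → w ∈ R → Reach G S w v

  ⊆grow : ∀ {R} → R ⊆ grow R
  ⊆grow {R} w∈R = Equivalence.from (∈-tabulate⇔ (λ w → w ∈? R ⊎-dec adjacent? R w)) (inj₁ w∈R)

  grow-reaches : ∀ {R} → Reaches R → Reaches (grow R)
  grow-reaches {R} reaches w∈ with Equivalence.to (∈-tabulate⇔ (λ w → w ∈? R ⊎-dec adjacent? R w)) w∈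
  ... | inj₁ w∈R                                  = reaches w∈R
  ... | inj₂ (e , e∉S , inj₁ (≡.refl , tgt∈R)) = fwd e e∉S (reaches tgt∈R)
  ... | inj₂ (e , e∉S , inj₂ (≡.refl , src∈R)) = bwd e e∉S (reaches src∈R)

  adjacent⇒∈grow : ∀ {R w} → Adjacent R w → w ∈ grow R
  adjacent⇒∈grow {R} adj =
    Equivalence.from (∈-tabulate⇔ (λ w → w ∈? R ⊎-dec adjacent? R w)) (inj₂ adj)

  closed⇒respects : ∀ {R} → grow R ⊆ R → ∀ e → e ∉ S → ⌊ src G e ∈? R ⌋ ≡ ⌊ tgt G e ∈? R ⌋
  closed⇒respects {R} closed e e∉S with src G e ∈? R | tgt G e ∈? R
  ... | yes _     | yes _     = ≡.refl
  ... | no _      | no _      = ≡.refl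
  ... | yes src∈R | no tgt∉R  =
    contradiction (closed (adjacent⇒∈grow (e , e∉S , inj₂ (≡.refl , src∈R)))) tgt∉R
  ... | no src∉R  | yes tgt∈R =
    contradiction (closed (adjacent⇒∈grow (e , e∉S , inj₁ (≡.refl , tgt∈R)))) src∉R

  Saturated : Set
  Saturated = Σ (Subset (n G)) λ R → Reaches R × v ∈ R × grow R ⊆ R

  -- Each non-final round adds a vertex, so k rounds suffice once n < ∣ R ∣ + k.
  saturate : ∀ k R → Reaches R → v ∈ R → n G ℕ.< ∣ R ∣ ℕ.+ k → Saturated
  saturate k R reaches v∈R bound with any? (λ w → w ∈? grow R ×-dec ¬? (w ∈? R))
  ... | no ¬new =
    R , reaches , v∈R , λ {w} w∈ → decidable-stable (w ∈? R) (λ w∉R → ¬new (w , w∈ , w∉R))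
  saturate zero R reaches v∈R bound | yes _ =
    contradiction (∣p∣≤n R) (ℕ.<⇒≱ (ℕ.≤-trans bound (ℕ.≤-reflexive (ℕ.+-identityʳ ∣ R ∣))))
  saturate (suc k) R reaches v∈R bound | yes new =
    saturate k (grow R) (grow-reaches reaches) (⊆grow v∈R) (ℕ.≤-trans bound grown)
    where
    grown : ∣ R ∣ ℕ.+ suc k ℕ.≤ ∣ grow R ∣ ℕ.+ k
    grown = ℕ.≤-trans (ℕ.≤-reflexive (ℕ.+-suc ∣ R ∣ k)) (ℕ.+-monoˡ-≤ k (p⊂q⇒∣p∣<∣q∣ (⊆grow , new)))

  reaches-v : Reaches ⁅ v ⁆
  reaches-v w∈ = ≡.subst (λ w → Reach G S w v) (≡.sym (x∈⁅y⁆⇒x≡y v w∈)) here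

  reach-or-separation : ∀ u → Reach G S u v ⊎ Separation G S u v
  reach-or-separation u with saturate (suc (n G)) ⁅ v ⁆ reaches-v (x∈⁅x⁆ v) (ℕ.m≤n+m _ _)
  ... | R , reaches , v∈R , closed with u ∈? R
  ...   | yes u∈R = inj₁ (reaches u∈R)
  ...   | no u∉R  = inj₂ record
    { side      = λ w → ⌊ w ∈? R ⌋
    ; separates = ⌊⌋-≢ (u ∈? R) (v ∈? R) u∉R v∈R
    ; respects  = closed⇒respects closed
    }


record TwoEdgeCut (G : Graph) : Set where
  field
    side        : Fin (n G) → Bool
    e₁ e₂       : Fin (m G)
    e₁≢e₂       : e₁ ≢ e₂
    e₁-crosses  : side (src G e₁) ≢ side (tgt G e₁)
    e₂-crosses  : side (src G e₂) ≢ side (tgt G e₂)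
    others-flat : ∀ e → e ≢ e₁ → e ≢ e₂ → side (src G e) ≡ side (tgt G e)

separation⇒TwoEdgeCut : ∀ G → EdgeConnected 2 G → ∀ {S u v} → ∣ S ∣ ℕ.< 3 → Separation G S u v →
                        TwoEdgeCut G
separation⇒TwoEdgeCut G connected {S} ∣S∣<3 sep = cut (∣p∣≡2⇒pair ∣C∣≡2)
  where
  open Separation sep
  C = crossing G side
  C⊆S : C ⊆ S
  C⊆S {e} e∈C = decidable-stable (e ∈? S) (Equivalence.to (∈crossing⇔ G side) e∈C ∘ respects e)
  ∣C∣≡2 : ∣ C ∣ ≡ 2
  ∣C∣≡2 = ℕ.≤-antisym (ℕ.≤-trans (p⊆q⇒∣p∣≤∣q∣ C⊆S) (ℕ.≤-pred ∣S∣<3))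
                      (EdgeConnected⇒∣crossing∣≥ G connected side separates)
  cut : (∃₂ λ e₁ e₂ → e₁ ≢ e₂ × e₁ ∈ C × e₂ ∈ C × (∀ e → e ∈ C → e ≡ e₁ ⊎ e ≡ e₂)) → TwoEdgeCut G
  cut (e₁ , e₂ , e₁≢e₂ , e₁∈C , e₂∈C , only) = record
    { side        = side
    ; e₁ = e₁ ; e₂ = e₂ ; e₁≢e₂ = e₁≢e₂
    ; e₁-crosses  = Equivalence.to (∈crossing⇔ G side) e₁∈C
    ; e₂-crosses  = Equivalence.to (∈crossing⇔ G side) e₂∈C
    ; others-flat = λ e e≢e₁ e≢e₂ → ∉crossing⇒flat G side e (λ e∈C → [ e≢e₁ , e≢e₂ ] (only e e∈C))
    }

¬TwoEdgeCut⇒EdgeConnected3 : ∀ G → EdgeConnected 2 G → ¬ TwoEdgeCut G → EdgeConnected 3 G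
¬TwoEdgeCut⇒EdgeConnected3 G connected no-cut S ∣S∣<3 u v with Saturation.reach-or-separation G S v u
... | inj₁ u⇝v = u⇝v
... | inj₂ sep = contradiction (separation⇒TwoEdgeCut G connected ∣S∣<3 sep) no-cut

module ℤΣ = FiniteSums ℤP.+-0-commutativeMonoid

Σℤ≡sum : ∀ {k} (f : Fin k → ℤ) → Σℤ f ≡ ℤΣ.sum f
Σℤ≡sum {zero}  f = ≡.refl
Σℤ≡sum {suc k} f = ≡.cong (ℤ._+_ (f zero)) (Σℤ≡sum (f ∘ suc))

sum-mono-≤ : ∀ {k} {f g : Fin k → ℤ} → (∀ i → f i ℤ.≤ g i) → ℤΣ.sum f ℤ.≤ ℤΣ.sum g
sum-mono-≤ {zero}  f≤g = ℤP.≤-refl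
sum-mono-≤ {suc k} f≤g = ℤP.+-mono-≤ (f≤g zero) (sum-mono-≤ (f≤g ∘ suc))

∣p∣≤sum : ∀ {k} (p : Subset k) {h : Fin k → ℤ} → (∀ i → 0ℤ ℤ.≤ h i) → (∀ i → i ∈ p → 1ℤ ℤ.≤ h i) →
          + ∣ p ∣ ℤ.≤ ℤΣ.sum h
∣p∣≤sum []          h≥0 p⇒h≥1 = ℤP.≤-refl
∣p∣≤sum (true ∷ p)  h≥0 p⇒h≥1 =
  ℤP.+-mono-≤ (p⇒h≥1 zero here) (∣p∣≤sum p (h≥0 ∘ suc) (λ i i∈p → p⇒h≥1 (suc i) (there i∈p)))
∣p∣≤sum (false ∷ p) h≥0 p⇒h≥1 =
  ℤP.+-mono-≤ (h≥0 zero) (∣p∣≤sum p (h≥0 ∘ suc) (λ i i∈p → p⇒h≥1 (suc i) (there i∈p)))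

argmax : ∀ {k} (f : Fin k → ℤ) → Fin k → ∃ λ j → ∀ i → f i ℤ.≤ f j
argmax {suc zero}    f _ = zero , λ { zero → ℤP.≤-refl }
argmax {suc (suc k)} f _ with argmax (f ∘ suc) zero
... | j , max-j with ℤP.≤-total (f zero) (f (suc j))
...   | inj₁ f0≤fj = suc j , λ { zero → f0≤fj ; (suc i) → max-j i }
...   | inj₂ fj≤f0 = zero , λ { zero → ℤP.≤-refl ; (suc i) → ℤP.≤-trans (max-j i) fj≤f0 }

i<j⇒1≤j-i : ∀ {i j} → i ℤ.< j → 1ℤ ℤ.≤ j ℤ.- i
i<j⇒1≤j-i {i} {j} i<j = ≡.subst (ℤ._≤ j ℤ.- i) (cancel i) (ℤP.+-monoˡ-≤ (ℤ.- i) (ℤP.i<j⇒suc[i]≤j i<j))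
  where
  cancel : ∀ i → (1ℤ ℤ.+ i) ℤ.- i ≡ 1ℤ
  cancel = solve-∀

module _ (G : Graph) where

  δ-self : ∀ y → δ G y y ≡ 1ℤ
  δ-self y with y ≟ y
  ... | yes _  = ≡.refl
  ... | no y≢y = contradiction ≡.refl y≢y

  δ-off : ∀ {y x} → y ≢ x → δ G y x ≡ 0ℤ
  δ-off {y} {x} y≢x with y ≟ x
  ... | yes y≡x = contradiction y≡x y≢x
  ... | no _    = ≡.refl

  δ-nonneg : ∀ y x → 0ℤ ℤ.≤ δ G y x
  δ-nonneg y x with y ≟ x
  ... | yes _ = ℤ.+≤+ z≤n
  ... | no _  = ℤP.≤-refl

  sum-δ : ∀ y → ℤΣ.sum (δ G y) ≡ 1ℤ
  sum-δ y = ≡.trans (ℤΣ.sum-point y (λ x x≢y → δ-off (x≢y ∘ ≡.sym))) (δ-self y)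

  eff2-nonneg : ∀ x₁ x₂ y → 0ℤ ℤ.≤ eff2 G x₁ x₂ y
  eff2-nonneg x₁ x₂ y = ℤP.+-mono-≤ (δ-nonneg x₁ y) (δ-nonneg x₂ y)

  deg-eff2 : ∀ x₁ x₂ → ℤΣ.sum (eff2 G x₁ x₂) ≡ + 2
  deg-eff2 x₁ x₂ = ≡.trans (ℤΣ.∑-distrib-+ (δ G x₁) (δ G x₂)) (≡.cong₂ ℤ._+_ (sum-δ x₁) (sum-δ x₂))

  S2-diff : ∀ x₀ x₁ x₂ y₁ y₂ y → S2 G x₀ x₁ x₂ y ℤ.- S2 G x₀ y₁ y₂ y ≡ eff2 G x₁ x₂ y ℤ.- eff2 G y₁ y₂ y
  S2-diff x₀ x₁ x₂ y₁ y₂ y = base-point-cancels (δ G x₁ y) (δ G x₂ y) (δ G y₁ y) (δ G y₂ y) (δ G x₀ y)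
    where
    base-point-cancels : ∀ a b c d o →
      ((a ℤ.- o) ℤ.+ (b ℤ.- o)) ℤ.- ((c ℤ.- o) ℤ.+ (d ℤ.- o)) ≡ (a ℤ.+ b) ℤ.- (c ℤ.+ d)
    base-point-cancels = solve-∀

  edgeDiv : (Fin (n G) → ℤ) → Fin (m G) → Fin (n G) → ℤ
  edgeDiv f e x = (if ⌊ src G e ≟ x ⌋ then f x ℤ.- f (tgt G e) else 0ℤ)
            ℤ.+ (if ⌊ tgt G e ≟ x ⌋ then f x ℤ.- f (src G e) else 0ℤ)

  divF≡sum-edgeDiv : ∀ f x → divF G f x ≡ ℤΣ.sum (λ e → edgeDiv f e x)
  divF≡sum-edgeDiv f x = Σℤ≡sum (λ e → edgeDiv f e x)

  edgeDiv-factor : ∀ f e x →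
    edgeDiv f e x ≡ (δ G (src G e) x ℤ.- δ G (tgt G e) x) ℤ.* (f (src G e) ℤ.- f (tgt G e))
  edgeDiv-factor f e x with src G e ≟ x | tgt G e ≟ x
  ... | yes s≡x    | yes t≡x    = contradiction (≡.trans s≡x (≡.sym t≡x)) (noLoop G e)
  ... | yes ≡.refl | no _       = at-src (f (src G e)) (f (tgt G e))
    where
    at-src : ∀ a b → (a ℤ.- b) ℤ.+ 0ℤ ≡ (1ℤ ℤ.- 0ℤ) ℤ.* (a ℤ.- b)
    at-src = solve-∀
  ... | no _       | yes ≡.refl = at-tgt (f (src G e)) (f (tgt G e))
    where
    at-tgt : ∀ a b → 0ℤ ℤ.+ (b ℤ.- a) ≡ (0ℤ ℤ.- 1ℤ) ℤ.* (a ℤ.- b)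
    at-tgt = solve-∀
  ... | no _       | no _       = elsewhere (f (src G e) ℤ.- f (tgt G e))
    where
    elsewhere : ∀ d → 0ℤ ℤ.+ 0ℤ ≡ (0ℤ ℤ.- 0ℤ) ℤ.* d
    elsewhere = solve-∀

  edgeDiv-flat : ∀ f e x → f (src G e) ≡ f (tgt G e) → edgeDiv f e x ≡ 0ℤ
  edgeDiv-flat f e x flat = begin
    edgeDiv f e x                       ≡⟨ edgeDiv-factor f e x ⟩
    c ℤ.* (f (src G e) ℤ.- f (tgt G e)) ≡⟨ ≡.cong (λ v → c ℤ.* (v ℤ.- f (tgt G e))) flat ⟩
    c ℤ.* (f (tgt G e) ℤ.- f (tgt G e)) ≡⟨ ≡.cong (c ℤ.*_) (ℤP.+-inverseʳ (f (tgt G e))) ⟩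
    c ℤ.* 0ℤ                            ≡⟨ ℤP.*-zeroʳ c ⟩
    0ℤ                                  ∎
    where
    open ≡.≡-Reasoning
    c = δ G (src G e) x ℤ.- δ G (tgt G e) x

  sumOver-edgeDiv : ∀ a f e → ℤΣ.sumOver a (edgeDiv f e) ≡
        (if a (src G e) then f (src G e) ℤ.- f (tgt G e) else 0ℤ)
    ℤ.+ (if a (tgt G e) then f (tgt G e) ℤ.- f (src G e) else 0ℤ)
  sumOver-edgeDiv a f e = ≡.trans (ℤΣ.sumOver-+ a _ _)
    (≡.cong₂ ℤ._+_ (ℤΣ.sumOver-point a (src G e) (λ x → f x ℤ.- f (tgt G e)))
                   (ℤΣ.sumOver-point a (tgt G e) (λ x → f x ℤ.- f (src G e))))

  eff2-self≢0 : ∀ x₁ x₂ → eff2 G x₁ x₂ x₁ ≢ 0ℤ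
  eff2-self≢0 x₁ x₂ with x₁ ≟ x₁ | x₂ ≟ x₁
  ... | yes _  | yes _ = λ ()
  ... | yes _  | no _  = λ ()
  ... | no x≢x | _     = contradiction ≡.refl x≢x

  eff2-off : ∀ {x₁ x₂ y} → x₁ ≢ y → x₂ ≢ y → eff2 G x₁ x₂ y ≡ 0ℤ
  eff2-off x₁≢y x₂≢y = ≡.cong₂ ℤ._+_ (δ-off x₁≢y) (δ-off x₂≢y)

module _ (G : Graph) (side : Fin (n G) → Bool) where

  indicator : Fin (n G) → ℤ
  indicator x = if side x then 1ℤ else 0ℤ

  inner outer : Fin (m G) → Fin (n G)
  inner e = if side (src G e) then src G e else tgt G e
  outer e = if side (src G e) then tgt G e else src G e

  module _ {e : Fin (m G)} (crosses : side (src G e) ≢ side (tgt G e)) where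

    inner-side : side (inner e) ≡ true
    inner-side with side (src G e) in src-side | side (tgt G e) in tgt-side
    ... | true  | _     = src-side
    ... | false | true  = tgt-side
    ... | false | false = contradiction ≡.refl crosses

    outer-side : side (outer e) ≡ false
    outer-side with side (src G e) in src-side | side (tgt G e) in tgt-side
    ... | true  | false = tgt-side
    ... | true  | true  = contradiction ≡.refl crosses
    ... | false | _     = src-side

    edgeDiv-indicator : ∀ x → edgeDiv G indicator e x ≡ δ G (inner e) x ℤ.- δ G (outer e) x
    edgeDiv-indicator x rewrite edgeDiv-factor G indicator e x with side (src G e) | side (tgt G e)
    ... | true  | false = ℤP.*-identityʳ _
    ... | false | true  = flip (δ G (src G e) x) (δ G (tgt G e) x)
      where
      flip : ∀ a b → (a ℤ.- b) ℤ.* (0ℤ ℤ.- 1ℤ) ≡ b ℤ.- a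
      flip = solve-∀
    ... | true  | true  = contradiction ≡.refl crosses
    ... | false | false = contradiction ≡.refl crosses

S2Injective⇒¬TwoEdgeCut : ∀ G x₀ → S2Injective G x₀ → ¬ TwoEdgeCut G
S2Injective⇒¬TwoEdgeCut G x₀ injective cut =
  eff2-self≢0 G in₁ in₂ (≡.trans (injective in₁ in₂ out₁ out₂ (indicator G side , principal) in₁)
                                  (eff2-off G (outer≢in₁ e₁-crosses) (outer≢in₁ e₂-crosses)))
  where
  open TwoEdgeCut cut
  in₁ = inner G side e₁
  in₂ = inner G side e₂
  out₁ = outer G side e₁
  out₂ = outer G side e₂

  outer≢in₁ : ∀ {e} → side (src G e) ≢ side (tgt G e) → outer G side e ≢ in₁
  outer≢in₁ crosses out≡in₁ =
    contradiction (≡.trans (≡.sym (outer-side G side crosses))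
                           (≡.trans (≡.cong side out≡in₁) (inner-side G side e₁-crosses))) λ ()

  div-indicator : ∀ y →
    divF G (indicator G side) y ≡ (δ G in₁ y ℤ.- δ G out₁ y) ℤ.+ (δ G in₂ y ℤ.- δ G out₂ y)
  div-indicator y = begin
    divF G (indicator G side) y
      ≡⟨ divF≡sum-edgeDiv G (indicator G side) y ⟩
    ℤΣ.sum (λ e → edgeDiv G (indicator G side) e y)
      ≡⟨ ℤΣ.sum-pair e₁ e₂ e₁≢e₂ (λ e e≢e₁ e≢e₂ → edgeDiv-flat G (indicator G side) e y
                                  (≡.cong (λ b → if b then 1ℤ else 0ℤ) (others-flat e e≢e₁ e≢e₂))) ⟩
    edgeDiv G (indicator G side) e₁ y ℤ.+ edgeDiv G (indicator G side) e₂ y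
      ≡⟨ ≡.cong₂ ℤ._+_ (edgeDiv-indicator G side e₁-crosses y) (edgeDiv-indicator G side e₂-crosses y) ⟩
    (δ G in₁ y ℤ.- δ G out₁ y) ℤ.+ (δ G in₂ y ℤ.- δ G out₂ y) ∎
    where open ≡.≡-Reasoning

  principal : ∀ y → S2 G x₀ in₁ in₂ y ℤ.- S2 G x₀ out₁ out₂ y ≡ divF G (indicator G side) y
  principal y = ≡.trans (S2-diff G x₀ in₁ in₂ out₁ out₂ y) (≡.trans
    (regroup (δ G in₁ y) (δ G in₂ y) (δ G out₁ y) (δ G out₂ y)) (≡.sym (div-indicator y)))
    where
    regroup : ∀ a b c d → (a ℤ.+ b) ℤ.- (c ℤ.+ d) ≡ (a ℤ.- c) ℤ.+ (b ℤ.- d)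
    regroup = solve-∀

module _ (G : Graph) (f : Fin (n G) → ℤ) (M : ℤ) (f≤M : ∀ x → f x ℤ.≤ M) where

  atMax : Fin (n G) → Bool
  atMax x = ⌊ f x ℤ.≟ M ⌋

  private
    drop-from-max : ∀ {x y} → f x ≡ M → f y ≢ M → 1ℤ ℤ.≤ f x ℤ.- f y
    drop-from-max {x} {y} fx≡M fy≢M =
      ≡.subst (λ v → 1ℤ ℤ.≤ v ℤ.- f y) (≡.sym fx≡M) (i<j⇒1≤j-i (ℤP.≤∧≢⇒< (f≤M y) fy≢M))

  outflow-bounds : ∀ e → 0ℤ ℤ.≤ ℤΣ.sumOver atMax (edgeDiv G f e) ×
                         (atMax (src G e) ≢ atMax (tgt G e) → 1ℤ ℤ.≤ ℤΣ.sumOver atMax (edgeDiv G f e))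
  outflow-bounds e rewrite sumOver-edgeDiv G atMax f e
    with f (src G e) ℤ.≟ M | f (tgt G e) ℤ.≟ M
  ... | yes src-max | yes tgt-max =
    ℤP.≤-reflexive (≡.sym (back-and-forth (f (src G e)) (f (tgt G e)))) ,
    λ crosses → contradiction ≡.refl crosses
    where
    back-and-forth : ∀ a b → (a ℤ.- b) ℤ.+ (b ℤ.- a) ≡ 0ℤ
    back-and-forth = solve-∀
  ... | yes src-max | no tgt-low =
    ℤP.≤-trans (ℤ.+≤+ z≤n) down , λ _ → down
    where
    down : 1ℤ ℤ.≤ (f (src G e) ℤ.- f (tgt G e)) ℤ.+ 0ℤ
    down = ≡.subst (1ℤ ℤ.≤_) (≡.sym (ℤP.+-identityʳ _)) (drop-from-max src-max tgt-low)
  ... | no src-low  | yes tgt-max =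
    ℤP.≤-trans (ℤ.+≤+ z≤n) down , λ _ → down
    where
    down : 1ℤ ℤ.≤ 0ℤ ℤ.+ (f (tgt G e) ℤ.- f (src G e))
    down = ≡.subst (1ℤ ℤ.≤_) (≡.sym (ℤP.+-identityˡ _)) (drop-from-max tgt-max src-low)
  ... | no src-low  | no tgt-low  =
    ℤP.≤-refl ,
    λ crosses → contradiction ≡.refl crosses

  ∣crossing-atMax∣≤deg : ∀ (D D′ : Fin (n G) → ℤ) → (∀ x → 0ℤ ℤ.≤ D x) → (∀ x → 0ℤ ℤ.≤ D′ x) →
                          (∀ x → D x ℤ.- D′ x ≡ divF G f x) → + ∣ crossing G atMax ∣ ℤ.≤ ℤΣ.sum D
  ∣crossing-atMax∣≤deg D D′ D≥0 D′≥0 principal = begin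
    + ∣ crossing G atMax ∣
      ≤⟨ ∣p∣≤sum (crossing G atMax) (proj₁ ∘ outflow-bounds)
                 (λ e e∈C → proj₂ (outflow-bounds e) (Equivalence.to (∈crossing⇔ G atMax) e∈C)) ⟩
    ℤΣ.sum (λ e → ℤΣ.sumOver atMax (edgeDiv G f e))
      ≡⟨ ≡.sym (ℤΣ.sumOver-sum atMax (edgeDiv G f)) ⟩
    ℤΣ.sumOver atMax (λ x → ℤΣ.sum (λ e → edgeDiv G f e x))
      ≡⟨ ℤΣ.sum-cong-≗ (λ x → ≡.cong (λ v → if atMax x then v else 0ℤ)
                         (≡.trans (≡.sym (divF≡sum-edgeDiv G f x)) (≡.sym (principal x)))) ⟩
    ℤΣ.sumOver atMax (λ x → D x ℤ.- D′ x)
      ≤⟨ sum-mono-≤ restricted≤D ⟩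
    ℤΣ.sum D ∎
    where
    open ℤP.≤-Reasoning
    restricted≤D : ∀ x → (if atMax x then D x ℤ.- D′ x else 0ℤ) ℤ.≤ D x
    restricted≤D x with atMax x
    ... | true  = ℤP.≤-trans (ℤP.+-monoʳ-≤ (D x) (ℤP.neg-mono-≤ (D′≥0 x)))
                             (ℤP.≤-reflexive (ℤP.+-identityʳ (D x)))
    ... | false = D≥0 x

EdgeConnected⇒principal-constant :
  ∀ G {k} → EdgeConnected k G → ∀ (D D′ f : Fin (n G) → ℤ) → (∀ x → 0ℤ ℤ.≤ D x) → (∀ x → 0ℤ ℤ.≤ D′ x) →
  ℤΣ.sum D ℤ.< + k → (∀ x → D x ℤ.- D′ x ≡ divF G f x) → ∀ x y → f x ≡ f y
EdgeConnected⇒principal-constant G connected D D′ f D≥0 D′≥0 deg<k principal x y with argmax f x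
... | top , f≤top with all? (λ x → f x ℤ.≟ f top)
...   | yes at-top = ≡.trans (at-top x) (≡.sym (at-top y))
...   | no ¬at-top with ¬∀⟶∃¬ (n G) _ (λ x → f x ℤ.≟ f top) ¬at-top
...     | low , f-low≢top = contradiction deg<k (ℤP.≤⇒≯ (ℤP.≤-trans (ℤ.+≤+ k≤∣C∣) ∣C∣≤deg))
  where
  k≤∣C∣ = EdgeConnected⇒∣crossing∣≥ G connected (atMax G f (f top) f≤top)
            (⌊⌋-≢ (f low ℤ.≟ f top) (f top ℤ.≟ f top) f-low≢top ≡.refl)
  ∣C∣≤deg = ∣crossing-atMax∣≤deg G f (f top) f≤top D D′ D≥0 D′≥0 principal

EdgeConnected3⇒S2Injective : ∀ G → EdgeConnected 3 G → ∀ x₀ → S2Injective G x₀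
EdgeConnected3⇒S2Injective G connected x₀ x₁ x₂ y₁ y₂ (f , principalS2) y =
  ℤP.i-j≡0⇒i≡j _ _ (≡.trans (principal y) (≡.trans (divF≡sum-edgeDiv G f y)
    (ℤΣ.sum-zero (λ e → edgeDiv-flat G f e y (f-constant (src G e) (tgt G e))))))
  where
  principal : ∀ y → eff2 G x₁ x₂ y ℤ.- eff2 G y₁ y₂ y ≡ divF G f y
  principal y = ≡.trans (≡.sym (S2-diff G x₀ x₁ x₂ y₁ y₂ y)) (principalS2 y)
  f-constant : ∀ x y → f x ≡ f y
  f-constant = EdgeConnected⇒principal-constant G connected (eff2 G x₁ x₂) (eff2 G y₁ y₂) f
    (eff2-nonneg G x₁ x₂) (eff2-nonneg G y₁ y₂)
    (ℤP.≤-<-trans (ℤP.≤-reflexive (deg-eff2 G x₁ x₂)) (ℤ.+<+ ℕ.≤-refl)) principal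

module ℚΣ = FiniteSums ℚP.+-0-commutativeMonoid

Σℚ≡sum : ∀ {k} (f : Fin k → ℚ) → Σℚ f ≡ ℚΣ.sum f
Σℚ≡sum {zero}  f = ≡.refl
Σℚ≡sum {suc k} f = ≡.cong (f zero ℚ.+_) (Σℚ≡sum (f ∘ suc))

zero⇔zero-of-± : ∀ {x a : ℚ} → x ≡ a ⊎ x ≡ ℚ.- a → (x ≡ 0ℚ ⇔ a ≡ 0ℚ)
zero⇔zero-of-± (inj₁ ≡.refl) = mk⇔ (λ x≡0 → x≡0) (λ a≡0 → a≡0)
zero⇔zero-of-± (inj₂ ≡.refl) = mk⇔ (λ -a≡0 → ℚP.neg-injective -a≡0) (≡.cong (λ a → ℚ.- a))

zero⇔zero-of-sum≡0 : ∀ {x y : ℚ} → x ℚ.+ y ≡ 0ℚ → (x ≡ 0ℚ ⇔ y ≡ 0ℚ)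
zero⇔zero-of-sum≡0 {x} {y} x+y≡0 = mk⇔
  (λ x≡0 → ≡.trans (≡.sym (ℚP.+-identityˡ y)) (≡.trans (≡.cong (ℚ._+ y) (≡.sym x≡0)) x+y≡0))
  (λ y≡0 → ≡.trans (≡.sym (ℚP.+-identityʳ x)) (≡.trans (≡.cong (x ℚ.+_) (≡.sym y≡0)) x+y≡0))

module _ (G : Graph) where

  netInflow : (Fin (m G) → ℚ) → Fin (n G) → ℚ
  netInflow ω x = ℚΣ.sum (inflow G ω x)

  flux : (Fin (n G) → Bool) → (Fin (m G) → ℚ) → Fin (m G) → ℚ
  flux side ω e = ℚΣ.sumOver side (λ x → inflow G ω x e)

  flux-value : ∀ side ω e → flux side ω e ≡
    (if side (tgt G e) then ω e else 0ℚ) ℚ.+ (if side (src G e) then ℚ.- ω e else 0ℚ)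
  flux-value side ω e = ≡.trans (ℚΣ.sumOver-+ side _ _)
    (≡.cong₂ ℚ._+_ (ℚΣ.sumOver-point side (tgt G e) (λ _ → ω e))
                   (ℚΣ.sumOver-point side (src G e) (λ _ → ℚ.- ω e)))

  flux-flat : ∀ side ω e → side (src G e) ≡ side (tgt G e) → flux side ω e ≡ 0ℚ
  flux-flat side ω e flat rewrite flux-value side ω e | flat with side (tgt G e)
  ... | true  = ℚP.+-inverseʳ (ω e)
  ... | false = ≡.refl

  flux-crossing : ∀ side ω e → side (src G e) ≢ side (tgt G e) →
                  flux side ω e ≡ ω e ⊎ flux side ω e ≡ ℚ.- ω e
  flux-crossing side ω e crosses rewrite flux-value side ω e with side (src G e) | side (tgt G e)
  ... | false | true  = inj₁ (ℚP.+-identityʳ (ω e))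
  ... | true  | false = inj₂ (ℚP.+-identityˡ (ℚ.- ω e))
  ... | true  | true  = contradiction ≡.refl crosses
  ... | false | false = contradiction ≡.refl crosses

  harmonic⇒total-flux≡0 : ∀ side ω → Harmonic G ω → ℚΣ.sum (flux side ω) ≡ 0ℚ
  harmonic⇒total-flux≡0 side ω harmonic = begin
    ℚΣ.sum (flux side ω)                                   ≡⟨ ℚΣ.sumOver-sum side (λ e x → inflow G ω x e) ⟨
    ℚΣ.sumOver side (λ x → ℚΣ.sum (λ e → inflow G ω x e)) ≡⟨ ℚΣ.sum-zero vanishes ⟩
    0ℚ                                                     ∎
    where
    open ≡.≡-Reasoning
    vanishes : ∀ x → (if side x then netInflow ω x else 0ℚ) ≡ 0ℚ
    vanishes x with side x
    ... | true  = ≡.trans (≡.sym (Σℚ≡sum (inflow G ω x))) (harmonic x)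
    ... | false = ≡.refl

PsiInjective⇒¬TwoEdgeCut : ∀ G → PsiInjective G → ¬ TwoEdgeCut G
PsiInjective⇒¬TwoEdgeCut G injective cut = e₁≢e₂ (injective e₁ e₂ same-zeros)
  where
  open TwoEdgeCut cut
  same-zeros : ∀ ω → Harmonic G ω → (ω e₁ ≡ 0ℚ) ⇔ (ω e₂ ≡ 0ℚ)
  same-zeros ω harmonic =
    ⇔-trans (⇔-sym (zero⇔zero-of-± (flux-crossing G side ω e₁ e₁-crosses)))
    (⇔-trans (zero⇔zero-of-sum≡0 flux₁+flux₂≡0) (zero⇔zero-of-± (flux-crossing G side ω e₂ e₂-crosses)))
    where
    flux₁+flux₂≡0 : flux G side ω e₁ ℚ.+ flux G side ω e₂ ≡ 0ℚ
    flux₁+flux₂≡0 = ≡.trans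
      (≡.sym (ℚΣ.sum-pair e₁ e₂ e₁≢e₂ λ e e≢e₁ e≢e₂ → flux-flat G side ω e (others-flat e e≢e₁ e≢e₂)))
      (harmonic⇒total-flux≡0 G side ω harmonic)

module _ (G : Graph) where

  open +-*-Solver using (solve; _:+_; _:-_; _:*_; :-_; _:=_; con)

  δℚ : Fin (n G) → Fin (n G) → ℚ
  δℚ y x = if ⌊ y ≟ x ⌋ then 1ℚ else 0ℚ

  unitFlow : Fin (m G) → ℚ → Fin (m G) → ℚ
  unitFlow e c i = if ⌊ i ≟ e ⌋ then c else 0ℚ

  walkFlow : ∀ {T x y} → Reach G T x y → Fin (m G) → ℚ
  walkFlow here          i = 0ℚ
  walkFlow (fwd e _ r) i = unitFlow e 1ℚ i ℚ.+ walkFlow r i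
  walkFlow (bwd e _ r) i = unitFlow e (ℚ.- 1ℚ) i ℚ.+ walkFlow r i

  inflow-+ : ∀ ω ω′ x e → inflow G (λ i → ω i ℚ.+ ω′ i) x e ≡ inflow G ω x e ℚ.+ inflow G ω′ x e
  inflow-+ ω ω′ x e with ⌊ tgt G e ≟ x ⌋ | ⌊ src G e ≟ x ⌋
  ... | true  | true  =
    solve 2 (λ a b → (a :+ b) :+ (:- (a :+ b)) := (a :+ (:- a)) :+ (b :+ (:- b))) ≡.refl (ω e) (ω′ e)
  ... | true  | false =
    solve 2 (λ a b → (a :+ b) :+ con 0ℚ := (a :+ con 0ℚ) :+ (b :+ con 0ℚ)) ≡.refl (ω e) (ω′ e)
  ... | false | true  =
    solve 2 (λ a b → con 0ℚ :+ (:- (a :+ b)) := (con 0ℚ :+ (:- a)) :+ (con 0ℚ :+ (:- b))) ≡.refl (ω e) (ω′ e)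
  ... | false | false = ≡.refl

  netInflow-+ : ∀ ω ω′ x → netInflow G (λ i → ω i ℚ.+ ω′ i) x ≡ netInflow G ω x ℚ.+ netInflow G ω′ x
  netInflow-+ ω ω′ x =
    ≡.trans (ℚΣ.sum-cong-≗ (inflow-+ ω ω′ x)) (ℚΣ.∑-distrib-+ (inflow G ω x) (inflow G ω′ x))

  netInflow-unitFlow : ∀ e c x → netInflow G (unitFlow e c) x ≡ c ℚ.* (δℚ (tgt G e) x ℚ.- δℚ (src G e) x)
  netInflow-unitFlow e c x = ≡.trans (ℚΣ.sum-point e off) at-e
    where
    off : ∀ i → i ≢ e → inflow G (unitFlow e c) x i ≡ 0ℚ
    off i i≢e with i ≟ e | ⌊ tgt G i ≟ x ⌋ | ⌊ src G i ≟ x ⌋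
    ... | yes i≡e | _     | _     = contradiction i≡e i≢e
    ... | no _    | true  | true  = ≡.refl
    ... | no _    | true  | false = ≡.refl
    ... | no _    | false | true  = ≡.refl
    ... | no _    | false | false = ≡.refl
    at-e : inflow G (unitFlow e c) x e ≡ c ℚ.* (δℚ (tgt G e) x ℚ.- δℚ (src G e) x)
    at-e with e ≟ e | tgt G e ≟ x | src G e ≟ x
    ... | no e≢e | _          | _          = contradiction ≡.refl e≢e
    ... | yes _  | yes t≡x    | yes s≡x    = contradiction (≡.trans s≡x (≡.sym t≡x)) (noLoop G e)
    ... | yes _  | yes _      | no _       = solve 1 (λ c → c :+ con 0ℚ := c :* (con 1ℚ :- con 0ℚ)) ≡.refl c
    ... | yes _  | no _       | yes _      = solve 1 (λ c → con 0ℚ :+ (:- c) := c :* (con 0ℚ :- con 1ℚ)) ≡.refl c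
    ... | yes _  | no _       | no _       = solve 1 (λ c → con 0ℚ :+ con 0ℚ := c :* (con 0ℚ :- con 0ℚ)) ≡.refl c

  netInflow-walkFlow : ∀ {T x y} (r : Reach G T x y) z → netInflow G (walkFlow r) z ≡ δℚ y z ℚ.- δℚ x z
  netInflow-walkFlow {y = y} here z = ≡.trans (ℚΣ.sum-zero inflow-0) (≡.sym (ℚP.+-inverseʳ (δℚ y z)))
    where
    inflow-0 : ∀ e → inflow G (λ _ → 0ℚ) z e ≡ 0ℚ
    inflow-0 e with ⌊ tgt G e ≟ z ⌋ | ⌊ src G e ≟ z ⌋
    ... | true  | true  = ≡.refl
    ... | true  | false = ≡.refl
    ... | false | true  = ≡.refl
    ... | false | false = ≡.refl
  netInflow-walkFlow {y = y} (fwd e e∉T r) z = begin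
    netInflow G (walkFlow (fwd e e∉T r)) z
      ≡⟨ netInflow-+ (unitFlow e 1ℚ) (walkFlow r) z ⟩
    netInflow G (unitFlow e 1ℚ) z ℚ.+ netInflow G (walkFlow r) z
      ≡⟨ ≡.cong₂ ℚ._+_ (netInflow-unitFlow e 1ℚ z) (netInflow-walkFlow r z) ⟩
    1ℚ ℚ.* (t ℚ.- s) ℚ.+ (δℚ y z ℚ.- t)
      ≡⟨ solve 3 (λ s t u → con 1ℚ :* (t :- s) :+ (u :- t) := u :- s) ≡.refl s t (δℚ y z) ⟩
    δℚ y z ℚ.- s ∎
    where
    open ≡.≡-Reasoning
    s = δℚ (src G e) z
    t = δℚ (tgt G e) z
  netInflow-walkFlow {y = y} (bwd e e∉T r) z = begin
    netInflow G (walkFlow (bwd e e∉T r)) z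
      ≡⟨ netInflow-+ (unitFlow e (ℚ.- 1ℚ)) (walkFlow r) z ⟩
    netInflow G (unitFlow e (ℚ.- 1ℚ)) z ℚ.+ netInflow G (walkFlow r) z
      ≡⟨ ≡.cong₂ ℚ._+_ (netInflow-unitFlow e (ℚ.- 1ℚ) z) (netInflow-walkFlow r z) ⟩
    (ℚ.- 1ℚ) ℚ.* (t ℚ.- s) ℚ.+ (δℚ y z ℚ.- s)
      ≡⟨ solve 3 (λ s t u → (:- con 1ℚ) :* (t :- s) :+ (u :- s) := u :- t) ≡.refl s t (δℚ y z) ⟩
    δℚ y z ℚ.- t ∎
    where
    open ≡.≡-Reasoning
    s = δℚ (src G e) z
    t = δℚ (tgt G e) z

  unitFlow-off : ∀ {e j} c → j ≢ e → unitFlow e c j ≡ 0ℚ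
  unitFlow-off {e} {j} c j≢e with j ≟ e
  ... | yes j≡e = contradiction j≡e j≢e
  ... | no _    = ≡.refl

  walkFlow-avoids : ∀ {T x y} (r : Reach G T x y) {j} → j ∈ T → walkFlow r j ≡ 0ℚ
  walkFlow-avoids here          j∈T = ≡.refl
  walkFlow-avoids (fwd e e∉T r) {j} j∈T =
    ≡.cong₂ ℚ._+_ (unitFlow-off {e} {j} 1ℚ λ { ≡.refl → e∉T j∈T }) (walkFlow-avoids r j∈T)
  walkFlow-avoids (bwd e e∉T r) {j} j∈T =
    ≡.cong₂ ℚ._+_ (unitFlow-off {e} {j} (ℚ.- 1ℚ) λ { ≡.refl → e∉T j∈T }) (walkFlow-avoids r j∈T)

EdgeConnected3⇒PsiInjective : ∀ G → EdgeConnected 3 G → PsiInjective G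
EdgeConnected3⇒PsiInjective G connected e e′ same-zeros with e ≟ e′
... | yes e≡e′ = e≡e′
... | no e≢e′  =
  contradiction (Equivalence.to (same-zeros ω harmonic) ω-e≡0) (λ ω-e′≡0 → ℚP.1≢0 (≡.trans (≡.sym ω-e′≡1) ω-e′≡0))
  where
  open +-*-Solver using (solve; _:+_; _:-_; _:*_; _:=_; con)
  T = ⁅ e ⁆ ∪ ⁅ e′ ⁆
  ∣T∣<3 : ∣ T ∣ ℕ.< 3
  ∣T∣<3 = s≤s (ℕ.≤-trans (∣p∪q∣≤∣p∣+∣q∣ ⁅ e ⁆ ⁅ e′ ⁆)
                         (ℕ.≤-reflexive (≡.cong₂ ℕ._+_ (∣⁅x⁆∣≡1 e) (∣⁅x⁆∣≡1 e′))))
  back : Reach G T (tgt G e′) (src G e′)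
  back = connected T ∣T∣<3 (tgt G e′) (src G e′)
  ω : Fin (m G) → ℚ
  ω i = unitFlow G e′ 1ℚ i ℚ.+ walkFlow G back i
  harmonic : Harmonic G ω
  harmonic z = begin
    Σℚ (inflow G ω z)
      ≡⟨ Σℚ≡sum (inflow G ω z) ⟩
    netInflow G ω z
      ≡⟨ netInflow-+ G (unitFlow G e′ 1ℚ) (walkFlow G back) z ⟩
    netInflow G (unitFlow G e′ 1ℚ) z ℚ.+ netInflow G (walkFlow G back) z
      ≡⟨ ≡.cong₂ ℚ._+_ (netInflow-unitFlow G e′ 1ℚ z) (netInflow-walkFlow G back z) ⟩
    1ℚ ℚ.* (t ℚ.- s) ℚ.+ (s ℚ.- t)
      ≡⟨ solve 2 (λ s t → con 1ℚ :* (t :- s) :+ (s :- t) := con 0ℚ) ≡.refl s t ⟩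
    0ℚ ∎
    where
    open ≡.≡-Reasoning
    s = δℚ G (src G e′) z
    t = δℚ G (tgt G e′) z
  ω-e≡0 : ω e ≡ 0ℚ
  ω-e≡0 = ≡.cong₂ ℚ._+_ (unitFlow-off G {e′} {e} 1ℚ e≢e′) (walkFlow-avoids G back (p⊆p∪q ⁅ e′ ⁆ (x∈⁅x⁆ e)))
  ω-e′≡1 : ω e′ ≡ 1ℚ
  ω-e′≡1 with e′ ≟ e′
  ... | yes _    =
    ≡.trans (≡.cong (1ℚ ℚ.+_) (walkFlow-avoids G back (q⊆p∪q ⁅ e ⁆ ⁅ e′ ⁆ (x∈⁅x⁆ e′)))) (ℚP.+-identityʳ 1ℚ)
  ... | no e′≢e′ = contradiction ≡.refl e′≢e′

proposition5p22 : (G : Graph) → EdgeConnected 1 G → EdgeConnected 2 G → (x₀ : Fin (n G)) →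
    (PsiInjective G ⇔ S2Injective G x₀) × (S2Injective G x₀ ⇔ EdgeConnected 3 G)
proposition5p22 G _ connected x₀ = ⇔-trans Psi⇔EC3 (⇔-sym S2⇔EC3) , S2⇔EC3
  where
  Psi⇔EC3 : PsiInjective G ⇔ EdgeConnected 3 G
  Psi⇔EC3 = mk⇔ (¬TwoEdgeCut⇒EdgeConnected3 G connected ∘ PsiInjective⇒¬TwoEdgeCut G)
                (EdgeConnected3⇒PsiInjective G)
  S2⇔EC3 : S2Injective G x₀ ⇔ EdgeConnected 3 G
  S2⇔EC3 = mk⇔ (¬TwoEdgeCut⇒EdgeConnected3 G connected ∘ S2Injective⇒¬TwoEdgeCut G x₀)
               (λ connected₃ → EdgeConnected3⇒S2Injective G connected₃ x₀)
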